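{- Let $G$ be a graph on $n$ vertices, $\ell$ a positive integer, and $M\subseteq V(G)$ with $|M|=k$ such that $Q=G-M$ is a clique, and assume $n\le\ell+k$. Let $C=\{c_1,\dots,c_\ell\}$, $C'=\{c'_v:v\in M\}$, and $V'$ a set of $\ell+k-n$ new (artificial) vertices. Let $B$ be the bipartite graph with bipartition $(V(G)\cup V',\,C\cup C')$ in which every $v\in V(G)$ is adjacent to all of $C$, each $v\in M$ is additionally adjacent to $c'_v$, and every vertex of $V'$ is adjacent to all of $C\cup C'$. For each edge $(v,c)$ of $B$ define $\mathcal{S}_{(v,c)}\subseteq 2^M$: if $v\in V(Q)$, $c\in C$, it consists of all $S\subseteq M$ such that $S\cup\{v\}$ is independent in $G$ and some $u\in V(G)$ has $N_G[u]\supseteq S\cup\{v\}$; if $v\in M$, $c\in C$, it consists of all independent $S\subseteq M$ with $v\in S$ such that some $u\in V(G)$ has $N_G[u]\supseteq S$; if $v\in V'$ or $c\in C'$, $\mathcal{S}_{(v,c)}=\{\emptyset\}$. With variables $x_u$ ($u\in M$) and $z_{(v,c)}$ (edges of $B$), let $P(v,c)=\sum_{S\in\mathcal{S}_{(v,c)}}\prod_{s\in S}x_s$ (empty product $=1$) and let $A$ be the square matrix with rows indexed by $V(G)\cup V'$, columns by $C\cup C'$, $A(v,c)=z_{(v,c)}P(v,c)$ for $(v,c)\in E(B)$ and $0$ otherwise. Then $G$ has a CD coloring with at most $\ell$ colors if and only if $\det A$ (a polynomial over $\mathbb{R}$) contains a monomial divisible by $\prod_{u\in M}x_u$.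
   Context: Graphs are finite and simple; $N_G[v]=N_G(v)\cup\{v\}$. A proper coloring assigns different colors to adjacent vertices. A vertex $v$ dominates a set $T$ if $T\subseteq N_G[v]$. A CD coloring of $G$ is a proper coloring in which every color class is dominated by some vertex of $G$. -}

module Defs where

open import Data.Nat as ℕ using (ℕ; zero; suc; _≤_; _∸_)
open import Data.Nat.Properties using (m+[n∸m]≡n)
open import Data.Bool using (Bool; true; false; if_then_else_; _∧_)
import Data.Bool as B
open import Data.Integer as ℤ using (ℤ)
open import Data.Fin as F using (Fin; splitAt; punchIn; cast; toℕ)
open import Data.Fin.Properties using (any?; all?)
open import Data.Fin.Subset using (Subset; _∈_; _∪_; ⁅_⁆; inside; outside)
open import Data.Fin.Subset.Properties using (_∈?_)
open import Data.Vec as V using (Vec; []; _∷_; tabulate; replicate; zipWith)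
open import Data.Vec.Properties as VP using ()
open import Data.List as L using (List; []; _∷_; _++_; map; concatMap; filter; foldr)
open import Data.Product using (Σ; ∃; _×_; _,_; proj₁; proj₂)
open import Data.Sum using (_⊎_; inj₁; inj₂)
open import Relation.Nullary using (Dec; yes; no; ¬_; does)
open import Relation.Nullary.Decidable using (_×-dec_; _⊎-dec_; _→-dec_; ¬?)
open import Relation.Binary.PropositionalEquality using (_≡_; _≢_; refl; sym)

record Graph (n : ℕ) : Set where
  field
    adj    : Fin n → Fin n → Bool
    adj-sym : ∀ u v → adj u v ≡ adj v u
    adj-irrefl : ∀ v → adj v v ≡ false
open Graph public

Adj : ∀ {n} → Graph n → Fin n → Fin n → Set
Adj G u v = adj G u v ≡ true

InClosedNbhd : ∀ {n} → Graph n → Fin n → Fin n → Set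
InClosedNbhd G u w = (w ≡ u) ⊎ Adj G u w

inClosedNbhd? : ∀ {n} (G : Graph n) u w → Dec (InClosedNbhd G u w)
inClosedNbhd? G u w = (w F.≟ u) ⊎-dec (adj G u w B.≟ true)

Dominates : ∀ {n} → Graph n → Fin n → Subset n → Set
Dominates G v T = ∀ w → w ∈ T → InClosedNbhd G v w

Dominated : ∀ {n} → Graph n → Subset n → Set
Dominated G T = ∃ λ u → Dominates G u T

dominated? : ∀ {n} (G : Graph n) T → Dec (Dominated G T)
dominated? G T = any? λ u → all? λ w → (w ∈? T) →-dec inClosedNbhd? G u w

Independent : ∀ {n} → Graph n → Subset n → Set
Independent G T = ∀ u w → u ∈ T → w ∈ T → ¬ Adj G u w

independent? : ∀ {n} (G : Graph n) T → Dec (Independent G T)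
independent? G T = all? λ u → all? λ w →
  (u ∈? T) →-dec ((w ∈? T) →-dec ¬? (adj G u w B.≟ true))

IsCDColoring : ∀ {n ℓ} → Graph n → (Fin n → Fin ℓ) → Set
IsCDColoring G col =
  (∀ u v → Adj G u v → col u ≢ col v) ×
  (∀ v → ∃ λ u → ∀ w → col w ≡ col v → InClosedNbhd G u w)

HasCDColoring : ∀ {n} → Graph n → ℕ → Set
HasCDColoring {n} G ℓ = Σ (Fin n → Fin ℓ) (IsCDColoring G)

-- Polynomials with integer coefficients in variables x_i (i : Fin k)
-- and z_(r,c) (r c : Fin N), as formal sums of terms.

record Mono (k N : ℕ) : Set where
  constructor mono
  field
    xexp : Vec ℕ k
    zexp : Vec (Vec ℕ N) N
open Mono public

mono-≟ : ∀ {k N} (m m' : Mono k N) → Dec (m ≡ m')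
mono-≟ (mono a b) (mono a' b') with VP.≡-dec ℕ._≟_ a a' | VP.≡-dec (VP.≡-dec ℕ._≟_) b b'
... | yes refl | yes refl = yes refl
... | no ¬p    | _        = no λ { refl → ¬p refl }
... | yes _    | no ¬q    = no λ { refl → ¬q refl }

Poly : ℕ → ℕ → Set
Poly k N = List (ℤ × Mono k N)

module _ {k N : ℕ} where

  oneM : Mono k N
  oneM = mono (replicate k 0) (replicate N (replicate N 0))

  _*M_ : Mono k N → Mono k N → Mono k N
  mono a b *M mono a' b' = mono (zipWith ℕ._+_ a a') (zipWith (zipWith ℕ._+_) b b')

  0P : Poly k N
  0P = []

  1P : Poly k N
  1P = (ℤ.1ℤ , oneM) ∷ []

  _+P_ : Poly k N → Poly k N → Poly k N
  _+P_ = _++_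

  _*P_ : Poly k N → Poly k N → Poly k N
  p *P q = concatMap (λ { (a , m) → map (λ { (b , m') → (a ℤ.* b , m *M m') }) q }) p

  scaleP : ℤ → Poly k N → Poly k N
  scaleP c = map λ { (a , m) → (c ℤ.* a , m) }

  sumP : List (Poly k N) → Poly k N
  sumP = foldr _+P_ 0P

  coeff : Poly k N → Mono k N → ℤ
  coeff p m = foldr (λ { (a , m') acc → if does (mono-≟ m' m) then a ℤ.+ acc else acc }) ℤ.0ℤ p

  zVar : Fin N → Fin N → Poly k N
  zVar r c = (ℤ.1ℤ , mono (replicate k 0)
                  (tabulate λ i → tabulate λ j →
                     if does (i F.≟ r) ∧ does (j F.≟ c) then 1 else 0)) ∷ []

  xProd : Subset k → Poly k N
  xProd S = (ℤ.1ℤ , mono (V.map (λ b → if b then 1 else 0) S)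
                         (replicate N (replicate N 0))) ∷ []

  AllXDivide : Mono k N → Set
  AllXDivide m = ∀ i → 1 ≤ V.lookup (xexp m) i

det : ∀ {k N} m → (Fin m → Fin m → Poly k N) → Poly k N
det zero    A = 1P
det (suc m) A = sumP (L.map (λ j →
  scaleP ((ℤ.- ℤ.1ℤ) ℤ.^ toℕ j)
         (A F.zero j *P det m (λ i c → A (F.suc i) (punchIn j c))))
  (L.allFin (suc m)))

allSubsets : ∀ k → List (Subset k)
allSubsets zero    = [] ∷ []
allSubsets (suc k) = map (outside ∷_) (allSubsets k) ++ map (inside ∷_) (allSubsets k)

-- The construction. M is the image of an injection ι : Fin k → Fin n;
-- x_i stands for x_{ι i} and column c'_{ι i} is the i-th column of C'.

module Construction {n k : ℕ} (G : Graph n) (ι : Fin k → Fin n) where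

  InM : Fin n → Set
  InM v = ∃ λ i → ι i ≡ v

  img : Subset k → Subset n
  img S = tabulate λ w → does (any? λ i → (i ∈? S) ×-dec (ι i F.≟ w))

  InFamQ : Fin n → Subset k → Set
  InFamQ v S = Independent G (img S ∪ ⁅ v ⁆) × Dominated G (img S ∪ ⁅ v ⁆)

  inFamQ? : ∀ v S → Dec (InFamQ v S)
  inFamQ? v S = independent? G (img S ∪ ⁅ v ⁆) ×-dec dominated? G (img S ∪ ⁅ v ⁆)

  InFamM : Fin n → Subset k → Set
  InFamM v S = Independent G (img S) × (v ∈ img S) × Dominated G (img S)

  inFamM? : ∀ v S → Dec (InFamM v S)
  inFamM? v S = independent? G (img S) ×-dec ((v ∈? img S) ×-dec dominated? G (img S))

  module _ {N : ℕ} where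
    famPoly : ∀ {P : Subset k → Set} → (∀ S → Dec (P S)) → Poly k N
    famPoly P? = sumP (map xProd (filter P? (allSubsets k)))

    PVC : Fin n → Poly k N
    PVC v with any? (λ i → ι i F.≟ v)
    ... | yes _ = famPoly (inFamM? v)
    ... | no  _ = famPoly (inFamQ? v)

  -- rows: V(G) ⊎ V' (|V'| = ℓ + k ∸ n); columns: C ⊎ C'
  module Matrix (ℓ : ℕ) (le : n ≤ ℓ ℕ.+ k) where
    N : ℕ
    N = ℓ ℕ.+ k

    rowOf : Fin N → Fin n ⊎ Fin (N ∸ n)
    rowOf r = splitAt n (cast (sym (m+[n∸m]≡n le)) r)

    colOf : Fin N → Fin ℓ ⊎ Fin k
    colOf c = splitAt ℓ c

    entryP : Fin n ⊎ Fin (N ∸ n) → Fin ℓ ⊎ Fin k → Poly k N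
    entryP (inj₁ v) (inj₁ c) = PVC v
    entryP (inj₁ v) (inj₂ i) = if does (ι i F.≟ v) then 1P else 0P
    entryP (inj₂ _) _        = 1P

    A : Fin N → Fin N → Poly k N
    A r c = zVar r c *P entryP (rowOf r) (colOf c)

    detA : Poly k N
    detA = det N A

{-# OPTIONS --safe #-}
-- The terms of det A correspond to transversals: a permutation σ together with a term
-- of each entry A(i, σ i). Every entry (r, c) is z_rc times a sum of x-monomials with
-- coefficient 1, so the z-part of a term records σ, hence its sign; terms with equal
-- monomials therefore never cancel, and det A has a monomial divisible by ∏ x_u iff
-- some transversal uses every x_u.
--
-- Given such a transversal, colour each vertex by the C-column of a row whose entry
-- term contains it: a vertex u of M through the row whose term contains x_u, a vertex of
-- Q through its own row (its C′-entries vanish). A C-column is used by one row only, so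
-- a colour class lies inside one set S ∪ {v} that is independent and dominated.
-- Conversely, given a CD colouring, send the leader of each colour class (its vertex in
-- the clique Q if there is one, some fixed vertex otherwise) to the column of its colour
-- and choose there the term ∏ x_u over the M-vertices u of the class; every other vertex
-- v lies in M and goes to c′_v, and the artificial rows take the remaining columns.
module Submission where

open import Defs
open import Data.Nat as ℕ using (ℕ; zero; suc; _≤_; _+_; _∸_; z≤n; s≤s)
import Data.Nat.Properties as ℕP
open import Data.Integer as ℤ using (ℤ; 0ℤ; 1ℤ; -1ℤ; +_)
import Data.Integer.Properties as ℤP
open import Data.Fin as F using (Fin; punchIn; punchOut; toℕ; _↑ˡ_; _↑ʳ_)
import Data.Fin.Properties as FP
open import Data.Fin.Properties using (any?; all?)
open import Data.Vec as V using (lookup; replicate; tabulate) renaming ([] to []ᵥ; _∷_ to _∷ᵥ_)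
import Data.Vec.Properties as VP
open import Data.Vec.Functional using () renaming (_∷_ to _∷ᶠ_)
open import Data.List as L using ([]; _∷_; map; filter)
open import Data.List.Membership.Propositional using (find; lose) renaming (_∈_ to _∈ₗ_)
open import Data.List.Membership.Propositional.Properties
  using (∈-map⁺; ∈-map⁻; ∈-++⁺ˡ; ∈-++⁺ʳ; ∈-concatMap⁺; ∈-concatMap⁻; ∈-filter⁺; ∈-filter⁻;
         ∈-allFin; ∈-length)
open import Data.List.Relation.Unary.Any using (here; there)
open import Data.Fin.Subset using (Subset; _∈_; _∪_; ⁅_⁆) renaming (⊥ to ∅)
import Data.Fin.Subset.Properties as SP
open import Data.Maybe as Maybe using (Maybe; just)
import Data.Maybe.Properties as MaybeP
open import Data.Product using (Σ; ∃; ∃₂; _×_; _,_; proj₁; proj₂)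
open import Data.Sum using (_⊎_; inj₁; inj₂; [_,_]; [_,_]′)
open import Function using (_∘_; id)
open import Function.Definitions using (Injective)
open import Function.Bundles using (_⇔_; mk⇔)
open import Function.Properties.Equivalence using () renaming (trans to ⇔-trans; sym to ⇔-sym)
open import Data.Bool using (true; false; if_then_else_; _∧_)
open import Data.Bool.Properties using (∧-zeroʳ)
open import Relation.Nullary using (¬_; Dec; yes; no; does; contradiction)
open import Relation.Nullary.Decidable using (dec-true; dec-false; dec⇒maybe; ¬?; _×-dec_; _⊎-dec_)
open import Relation.Binary.PropositionalEquality
  using (_≡_; _≢_; refl; sym; trans; cong; cong₂; subst; module ≡-Reasoning)
open ≡-Reasoning

fresh-cons-injective : ∀ {a M} {y : Fin M} {f : Fin a → Fin M} → (∀ x → f x ≢ y) →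
                       Injective _≡_ _≡_ f → Injective _≡_ _≡_ (y ∷ᶠ f)
fresh-cons-injective y∉f f-inj {F.zero}  {F.zero}  _ = refl
fresh-cons-injective y∉f f-inj {F.zero}  {F.suc x} e = contradiction (sym e) (y∉f x)
fresh-cons-injective y∉f f-inj {F.suc x} {F.zero}  e = contradiction e (y∉f x)
fresh-cons-injective y∉f f-inj {F.suc x} {F.suc _} e = cong F.suc (f-inj e)

module _ {m} {σ : Fin (suc m) → Fin (suc m)} (σ-inj : Injective _≡_ _≡_ σ) where

  private
    σ₀≢σsuc : ∀ i → σ F.zero ≢ σ (F.suc i)
    σ₀≢σsuc i e with σ-inj e
    ... | ()

  removeFirst : Fin m → Fin m
  removeFirst i = punchOut (σ₀≢σsuc i)

  removeFirst-injective : Injective _≡_ _≡_ removeFirst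
  removeFirst-injective {x} {y} e =
    FP.suc-injective (σ-inj (FP.punchOut-injective (σ₀≢σsuc x) (σ₀≢σsuc y) e))

  punchIn-removeFirst : ∀ i → punchIn (σ F.zero) (removeFirst i) ≡ σ (F.suc i)
  punchIn-removeFirst i = FP.punchIn-punchOut (σ₀≢σsuc i)

↑ˡ≢↑ʳ : ∀ {m n} (i : Fin m) (j : Fin n) → i ↑ˡ n ≢ m ↑ʳ j
↑ˡ≢↑ʳ {m} {n} i j e
  with () ← trans (sym (FP.splitAt-↑ˡ m i n)) (trans (cong (F.splitAt m) e) (FP.splitAt-↑ʳ m n j))

freshValue : ∀ {a M} → a ℕ.< M → (f : Fin a → Fin M) → ∃ λ y → ∀ x → f x ≢ y
freshValue {a} {M} a<M f with any? (λ y → all? (λ x → ¬? (f x F.≟ y)))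
... | yes fresh = fresh
... | no ¬fresh = contradiction (FP.injective⇒≤ section-injective) (ℕP.<⇒≱ a<M)
  where
  preimage : ∀ y → ∃ λ x → f x ≡ y
  preimage y with any? (λ x → f x F.≟ y)
  ... | yes found = found
  ... | no ¬found = contradiction (y , λ x e → ¬found (x , e)) ¬fresh

  section-injective : Injective _≡_ _≡_ (proj₁ ∘ preimage)
  section-injective {y} {y′} e =
    trans (sym (proj₂ (preimage y))) (trans (cong f e) (proj₂ (preimage y′)))

[,]-injective : ∀ {a b M} {f : Fin a → Fin M} {g : Fin b → Fin M} →
                Injective _≡_ _≡_ f → Injective _≡_ _≡_ g → (∀ x y → f x ≢ g y) →
                Injective _≡_ _≡_ [ f , g ]′
[,]-injective f-inj g-inj f∉g {inj₁ x} {inj₁ _} e = cong inj₁ (f-inj e)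
[,]-injective f-inj g-inj f∉g {inj₂ y} {inj₂ _} e = cong inj₂ (g-inj e)
[,]-injective f-inj g-inj f∉g {inj₁ x} {inj₂ y} e = contradiction e (f∉g x y)
[,]-injective f-inj g-inj f∉g {inj₂ y} {inj₁ x} e = contradiction (sym e) (f∉g x y)

complementInjection : ∀ {a M} b → a + b ≡ M → (f : Fin a → Fin M) → Injective _≡_ _≡_ f →
                      ∃ λ (g : Fin b → Fin M) → Injective _≡_ _≡_ g × (∀ x y → f x ≢ g y)
complementInjection zero    _ f _ = (λ ()) , (λ { {()} }) , λ _ ()
complementInjection {a} (suc b) a+b≡M f f-inj
  with y , y∉f ← freshValue (subst (a ℕ.<_) a+b≡M (ℕP.m<m+n a (s≤s z≤n))) f
  with g , g-inj , f′∉g ← complementInjection b (trans (sym (ℕP.+-suc a b)) a+b≡M)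
                                             (y ∷ᶠ f) (fresh-cons-injective y∉f f-inj)
  = y ∷ᶠ g , fresh-cons-injective (λ z e → f′∉g F.zero z (sym e)) g-inj ,
    λ { x F.zero → y∉f x ; x (F.suc z) → f′∉g (F.suc x) z }

module Terms {k N : ℕ} where

  Term : Set
  Term = ℤ × Mono k N

  xDeg : Term → Fin k → ℕ
  xDeg t u = lookup (xexp (proj₂ t)) u

  zDeg : Term → Fin N → Fin N → ℕ
  zDeg t r c = lookup (lookup (zexp (proj₂ t)) r) c

  XDivides : Fin k → Term → Set
  XDivides u t = 1 ≤ xDeg t u

  oneT : Term
  oneT = (1ℤ , oneM)

  _*T_ : Term → Term → Term
  (a , m) *T (b , m′) = (a ℤ.* b , m *M m′)

  scaleT : ℤ → Term → Term
  scaleT c (a , m) = (c ℤ.* a , m)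

  zDeg-oneT : ∀ r c → zDeg oneT r c ≡ 0
  zDeg-oneT r c rewrite VP.lookup-replicate r (replicate N 0) = VP.lookup-replicate c 0

  xDeg-*T : ∀ t₁ t₂ u → xDeg (t₁ *T t₂) u ≡ xDeg t₁ u + xDeg t₂ u
  xDeg-*T (_ , mono x₁ _) (_ , mono x₂ _) u = VP.lookup-zipWith _+_ u x₁ x₂

  zDeg-*T : ∀ t₁ t₂ r c → zDeg (t₁ *T t₂) r c ≡ zDeg t₁ r c + zDeg t₂ r c
  zDeg-*T (_ , mono _ z₁) (_ , mono _ z₂) r c = begin
    lookup (lookup (V.zipWith (V.zipWith _+_) z₁ z₂) r) c
      ≡⟨ cong (λ row → lookup row c) (VP.lookup-zipWith (V.zipWith _+_) r z₁ z₂) ⟩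
    lookup (V.zipWith _+_ (lookup z₁ r) (lookup z₂ r)) c
      ≡⟨ VP.lookup-zipWith _+_ c (lookup z₁ r) (lookup z₂ r) ⟩
    lookup (lookup z₁ r) c + lookup (lookup z₂ r) c ∎

  ¬XDivides-x-free : ∀ {u} t → xexp (proj₂ t) ≡ replicate k 0 → ¬ XDivides u t
  ¬XDivides-x-free {u} t refl d with () ← subst (1 ≤_) (VP.lookup-replicate u 0) d

  XDivides-*T⁻ : ∀ {u} t₁ t₂ → XDivides u (t₁ *T t₂) → XDivides u t₁ ⊎ XDivides u t₂
  XDivides-*T⁻ {u} t₁ t₂ d with xDeg t₁ u in e
  ... | suc _ = inj₁ (s≤s z≤n)
  ... | zero  = inj₂ (subst (1 ≤_) (trans (xDeg-*T t₁ t₂ u) (cong (_+ xDeg t₂ u) e)) d)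

  XDivides-*Tˡ : ∀ {u} t₁ t₂ → XDivides u t₁ → XDivides u (t₁ *T t₂)
  XDivides-*Tˡ {u} t₁ t₂ d =
    subst (1 ≤_) (sym (xDeg-*T t₁ t₂ u)) (ℕP.≤-trans d (ℕP.m≤m+n _ _))

  XDivides-*Tʳ : ∀ {u} t₁ t₂ → XDivides u t₂ → XDivides u (t₁ *T t₂)
  XDivides-*Tʳ {u} t₁ t₂ d =
    subst (1 ≤_) (sym (xDeg-*T t₁ t₂ u)) (ℕP.≤-trans d (ℕP.m≤n+m _ _))

  ∈-*P⁻ : ∀ (p q : Poly k N) {t} → t ∈ₗ p *P q →
          ∃₂ λ t₁ t₂ → t₁ ∈ₗ p × t₂ ∈ₗ q × t ≡ t₁ *T t₂
  ∈-*P⁻ p q t∈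
    with t₁ , t₁∈ , t∈′ ← find (∈-concatMap⁻ (λ t₁ → map (t₁ *T_) q) {xs = p} t∈)
    with t₂ , t₂∈ , refl ← ∈-map⁻ (t₁ *T_) t∈′
    = t₁ , t₂ , t₁∈ , t₂∈ , refl

  ∈-*P⁺ : ∀ {p q : Poly k N} {t₁ t₂} → t₁ ∈ₗ p → t₂ ∈ₗ q → t₁ *T t₂ ∈ₗ p *P q
  ∈-*P⁺ {q = q} {t₁} {t₂} t₁∈ t₂∈ =
    ∈-concatMap⁺ (λ t → map (t *T_) q)
      (lose {P = λ t → t₁ *T t₂ ∈ₗ map (t *T_) q} t₁∈ (∈-map⁺ (t₁ *T_) t₂∈))

module Coefficients {k N : ℕ} where
  open Terms {k} {N}

  coeff≢0⇒∈ : ∀ (p : Poly k N) m → coeff p m ≢ 0ℤ → ∃ λ a → (a , m) ∈ₗ p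
  coeff≢0⇒∈ []             m c≢0 = contradiction refl c≢0
  coeff≢0⇒∈ ((a , m′) ∷ p) m c≢0 with mono-≟ m′ m
  ... | yes refl = a , here refl
  ... | no _ with b , b∈ ← coeff≢0⇒∈ p m c≢0 = b , there b∈

  occurrences : Poly k N → Mono k N → ℕ
  occurrences p m = L.length (filter (λ t → mono-≟ (proj₂ t) m) p)

  coeff-uniform : ∀ (p : Poly k N) m a → (∀ {b} → (b , m) ∈ₗ p → b ≡ a) →
                  coeff p m ≡ a ℤ.* + occurrences p m
  coeff-uniform []             m a _   = sym (ℤP.*-zeroʳ a)
  coeff-uniform ((b , m′) ∷ p) m a all with mono-≟ m′ m
  ... | no _     = coeff-uniform p m a (all ∘ there)
  ... | yes refl = begin
    b ℤ.+ coeff p m                       ≡⟨ cong₂ ℤ._+_ (all (here refl)) (coeff-uniform p m a (all ∘ there)) ⟩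
    a ℤ.+ a ℤ.* + occurrences p m         ≡⟨ cong (ℤ._+ a ℤ.* + occurrences p m) (sym (ℤP.*-identityʳ a)) ⟩
    a ℤ.* 1ℤ ℤ.+ a ℤ.* + occurrences p m  ≡⟨ sym (ℤP.*-distribˡ-+ a 1ℤ (+ occurrences p m)) ⟩
    a ℤ.* + suc (occurrences p m)         ∎

  coeff-uniform-≢0 : ∀ (p : Poly k N) {m a} → a ≢ 0ℤ → (a , m) ∈ₗ p →
                     (∀ {b} → (b , m) ∈ₗ p → b ≡ a) → coeff p m ≢ 0ℤ
  coeff-uniform-≢0 p {m} {a} a≢0 a∈ all c≡0
    with ℤP.i*j≡0⇒i≡0∨j≡0 a (trans (sym (coeff-uniform p m a all)) c≡0)
  ... | inj₁ a≡0 = a≢0 a≡0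
  ... | inj₂ o≡0 = ℕP.<⇒≢ occurs (sym (ℤP.+-injective o≡0))
    where
    occurs : 0 ℕ.< occurrences p m
    occurs = ∈-length (∈-filter⁺ (λ t → mono-≟ (proj₂ t) m) a∈ refl)

module Determinant {k N : ℕ} where
  open Terms {k} {N}
  open Coefficients {k} {N}

  PolyMatrix : ℕ → Set
  PolyMatrix m = Fin m → Fin m → Poly k N

  minor : ∀ {m} → PolyMatrix (suc m) → Fin (suc m) → PolyMatrix m
  minor A j i c = A (F.suc i) (punchIn j c)

  sign : ∀ {m} → Fin m → ℤ
  sign j = (ℤ.- 1ℤ) ℤ.^ toℕ j

  ∈-det⁻ : ∀ {m} (A : PolyMatrix (suc m)) {t} → t ∈ₗ det (suc m) A →
           ∃ λ j → ∃₂ λ t₁ t₂ → t₁ ∈ₗ A F.zero j × t₂ ∈ₗ det m (minor A j) ×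
                               t ≡ scaleT (sign j) (t₁ *T t₂)
  ∈-det⁻ {m} A t∈
    with j , _ , t∈ⱼ ← find (∈-concatMap⁻ (λ j → scaleP (sign j) (A F.zero j *P det m (minor A j)))
                                           {xs = L.allFin (suc m)} t∈)
    with t′ , t′∈ , refl ← ∈-map⁻ (scaleT (sign j)) t∈ⱼ
    with t₁ , t₂ , t₁∈ , t₂∈ , refl ← ∈-*P⁻ (A F.zero j) (det m (minor A j)) t′∈
    = j , t₁ , t₂ , t₁∈ , t₂∈ , refl

  ∈-det⁺ : ∀ {m} (A : PolyMatrix (suc m)) {j t₁ t₂} → t₁ ∈ₗ A F.zero j → t₂ ∈ₗ det m (minor A j) →
           scaleT (sign j) (t₁ *T t₂) ∈ₗ det (suc m) A
  ∈-det⁺ {m} A {j} t₁∈ t₂∈ =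
    ∈-concatMap⁺ (λ j → scaleP (sign j) (A F.zero j *P det m (minor A j)))
      (lose {P = λ j′ → _ ∈ₗ scaleP (sign j′) (A F.zero j′ *P det m (minor A j′))}
            (∈-allFin j) (∈-map⁺ (scaleT (sign j)) (∈-*P⁺ t₁∈ t₂∈)))

  record Transversal {m} (A : PolyMatrix m) : Set where
    field
      σ           : Fin m → Fin m
      σ-injective : Injective _≡_ _≡_ σ
      term        : Fin m → Term
      term∈       : ∀ i → term i ∈ₗ A i (σ i)

  Covering : ∀ {m} {A : PolyMatrix m} → Transversal A → Set
  Covering T = ∀ u → ∃ λ i → XDivides u (Transversal.term T i)

  det-term⇒transversal : ∀ m (A : PolyMatrix m) {t} → t ∈ₗ det m A →
    Σ (Transversal A) λ T → ∀ {u} → XDivides u t → ∃ λ i → XDivides u (Transversal.term T i)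
  det-term⇒transversal zero A (here refl) =
    record { σ = λ () ; σ-injective = λ { {()} } ; term = λ () ; term∈ = λ () } ,
    λ d → contradiction d (¬XDivides-x-free oneT refl)
  det-term⇒transversal (suc m) A t∈
    with j , t₁ , t₂ , t₁∈ , t₂∈ , refl ← ∈-det⁻ A t∈
    with T , covers ← det-term⇒transversal m (minor A j) t₂∈
    = record { σ = j ∷ᶠ (punchIn j ∘ σ)
             ; σ-injective = fresh-cons-injective (FP.punchInᵢ≢i j ∘ σ) (σ-injective ∘ FP.punchIn-injective j _ _)
             ; term = t₁ ∷ᶠ term
             ; term∈ = λ { F.zero → t₁∈ ; (F.suc i) → term∈ i } } ,
      λ d → [ (λ d₁ → F.zero , d₁) , (λ d₂ → let i , dᵢ = covers d₂ in F.suc i , dᵢ) ]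
              (XDivides-*T⁻ t₁ t₂ d)
    where open Transversal T

  restrict : ∀ {m} {A : PolyMatrix (suc m)} (T : Transversal A) →
             Transversal (minor A (Transversal.σ T F.zero))
  restrict {A = A} T = record
    { σ = removeFirst σ-injective
    ; σ-injective = removeFirst-injective σ-injective
    ; term = term ∘ F.suc
    ; term∈ = λ i → subst (λ c → term (F.suc i) ∈ₗ A (F.suc i) c)
                          (sym (punchIn-removeFirst σ-injective i)) (term∈ (F.suc i))
    }
    where open Transversal T

  transversal⇒det-term : ∀ m (A : PolyMatrix m) (T : Transversal A) →
    ∃ λ t → t ∈ₗ det m A × ∀ {u} i → XDivides u (Transversal.term T i) → XDivides u t
  transversal⇒det-term zero A T = oneT , here refl , λ ()
  transversal⇒det-term (suc m) A T
    with t₂ , t₂∈ , covered ← transversal⇒det-term m _ (restrict T)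
    = _ , ∈-det⁺ A (term∈ F.zero) t₂∈ ,
      λ { F.zero d → XDivides-*Tˡ (term F.zero) t₂ d
        ; (F.suc i) d → XDivides-*Tʳ (term F.zero) t₂ (covered i d) }
    where open Transversal T

  zUnit : Fin N → Fin N → Fin N → Fin N → ℕ
  zUnit r c r′ c′ = if does (r′ F.≟ r) ∧ does (c′ F.≟ c) then 1 else 0

  zUnit-diag : ∀ r c → zUnit r c r c ≡ 1
  zUnit-diag r c rewrite dec-true (r F.≟ r) refl | dec-true (c F.≟ c) refl = refl

  zUnit-≢ʳ : ∀ {r r′} c c′ → r′ ≢ r → zUnit r c r′ c′ ≡ 0
  zUnit-≢ʳ {r} {r′} c c′ r′≢r rewrite dec-false (r′ F.≟ r) r′≢r = refl

  zUnit-≢ᶜ : ∀ r r′ {c c′} → c′ ≢ c → zUnit r c r′ c′ ≡ 0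
  zUnit-≢ᶜ r r′ {c} {c′} c′≢c
    rewrite dec-false (c′ F.≟ c) c′≢c | ∧-zeroʳ (does (r′ F.≟ r)) = refl

  IsZLabelled : ∀ {m} → (Fin m → Fin N) → (Fin m → Fin N) → PolyMatrix m → Set
  IsZLabelled ρ κ A = ∀ i c {t} → t ∈ₗ A i c →
                      proj₁ t ≡ 1ℤ × (∀ r c′ → zDeg t r c′ ≡ zUnit (ρ i) (κ c) r c′)

  minor-labelled : ∀ {m} {A : PolyMatrix (suc m)} {ρ κ} j → IsZLabelled ρ κ A →
                   IsZLabelled (ρ ∘ F.suc) (κ ∘ punchIn j) (minor A j)
  minor-labelled j lab i c = lab (F.suc i) (punchIn j c)

  det-zDeg-unlabelled : ∀ m {A : PolyMatrix m} {ρ κ} → IsZLabelled ρ κ A → ∀ {t} → t ∈ₗ det m A →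
                        ∀ {r} → (∀ i → ρ i ≢ r) → ∀ c → zDeg t r c ≡ 0
  det-zDeg-unlabelled zero    lab (here refl) _ c = zDeg-oneT _ c
  det-zDeg-unlabelled (suc m) {A} {ρ} {κ} lab t∈ {r} r∉ρ c
    with j , t₁ , t₂ , t₁∈ , t₂∈ , refl ← ∈-det⁻ A t∈ = begin
    zDeg (t₁ *T t₂) r c         ≡⟨ zDeg-*T t₁ t₂ r c ⟩
    zDeg t₁ r c + zDeg t₂ r c   ≡⟨ cong₂ _+_ (proj₂ (lab F.zero j t₁∈) r c)
                                             (det-zDeg-unlabelled m (minor-labelled j lab) t₂∈ (r∉ρ ∘ F.suc) c) ⟩
    zUnit (ρ F.zero) (κ j) r c + 0
                                ≡⟨ cong (_+ 0) (zUnit-≢ʳ (κ j) c (λ r≡ρ₀ → r∉ρ F.zero (sym r≡ρ₀))) ⟩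
    0                           ∎

  Unit : ℤ → Set
  Unit a = a ≡ 1ℤ ⊎ a ≡ -1ℤ

  Unit⇒≢0 : ∀ {a} → Unit a → a ≢ 0ℤ
  Unit⇒≢0 (inj₁ refl) ()
  Unit⇒≢0 (inj₂ refl) ()

  Unit-* : ∀ {a b} → Unit a → Unit b → Unit (a ℤ.* b)
  Unit-* (inj₁ refl) (inj₁ refl) = inj₁ refl
  Unit-* (inj₁ refl) (inj₂ refl) = inj₂ refl
  Unit-* (inj₂ refl) (inj₁ refl) = inj₂ refl
  Unit-* (inj₂ refl) (inj₂ refl) = inj₁ refl

  Unit-^ : ∀ n → Unit ((ℤ.- 1ℤ) ℤ.^ n)
  Unit-^ zero    = inj₁ refl
  Unit-^ (suc n) = Unit-* (inj₂ refl) (Unit-^ n)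

  det-coefficient-unit : ∀ m {A : PolyMatrix m} {ρ κ} → IsZLabelled ρ κ A →
                         ∀ {t} → t ∈ₗ det m A → Unit (proj₁ t)
  det-coefficient-unit zero    lab (here refl) = inj₁ refl
  det-coefficient-unit (suc m) {A} lab t∈
    with j , t₁ , t₂ , t₁∈ , t₂∈ , refl ← ∈-det⁻ A t∈ =
    Unit-* (Unit-^ (toℕ j))
           (Unit-* (inj₁ (proj₁ (lab F.zero j t₁∈)))
                   (det-coefficient-unit m (minor-labelled j lab) t₂∈))

  SameZ : Term → Term → Set
  SameZ t t′ = ∀ r c → zDeg t r c ≡ zDeg t′ r c

  first-row-zDeg : ∀ {m} {A : PolyMatrix (suc m)} {ρ κ} → Injective _≡_ _≡_ ρ → IsZLabelled ρ κ A →
                   ∀ {j t₁ t₂} → t₁ ∈ₗ A F.zero j → t₂ ∈ₗ det m (minor A j) →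
                   ∀ c → zDeg (t₁ *T t₂) (ρ F.zero) c ≡ zUnit (ρ F.zero) (κ j) (ρ F.zero) c
  first-row-zDeg {m} {ρ = ρ} {κ} ρ-inj lab {j} {t₁} {t₂} t₁∈ t₂∈ c = begin
    zDeg (t₁ *T t₂) (ρ F.zero) c                    ≡⟨ zDeg-*T t₁ t₂ (ρ F.zero) c ⟩
    zDeg t₁ (ρ F.zero) c + zDeg t₂ (ρ F.zero) c     ≡⟨ cong₂ _+_ (proj₂ (lab F.zero j t₁∈) (ρ F.zero) c)
                                                         (det-zDeg-unlabelled m (minor-labelled j lab) t₂∈ ρsuc≢ρ₀ c) ⟩
    zUnit (ρ F.zero) (κ j) (ρ F.zero) c + 0         ≡⟨ ℕP.+-identityʳ _ ⟩
    zUnit (ρ F.zero) (κ j) (ρ F.zero) c             ∎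
    where
    ρsuc≢ρ₀ : ∀ i → ρ (F.suc i) ≢ ρ F.zero
    ρsuc≢ρ₀ i e with ρ-inj e
    ... | ()

  det-coefficient-determined : ∀ m {A : PolyMatrix m} {ρ κ} → Injective _≡_ _≡_ ρ → Injective _≡_ _≡_ κ →
    IsZLabelled ρ κ A → ∀ {t t′} → t ∈ₗ det m A → t′ ∈ₗ det m A →
    SameZ t t′ → proj₁ t ≡ proj₁ t′
  det-coefficient-determined zero    _ _ _ (here refl) (here refl) _ = refl
  det-coefficient-determined (suc m) {A} {ρ} {κ} ρ-inj κ-inj lab t∈ t′∈ sameZ
    with j  , t₁  , t₂  , t₁∈  , t₂∈  , refl ← ∈-det⁻ A t∈
    with j′ , t₁′ , t₂′ , t₁′∈ , t₂′∈ , refl ← ∈-det⁻ A t′∈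
    with j F.≟ j′
  ... | no j≢j′ = contradiction (begin
    1                                         ≡⟨ sym (zUnit-diag (ρ F.zero) (κ j)) ⟩
    zUnit (ρ F.zero) (κ j) (ρ F.zero) (κ j)   ≡⟨ sym (first-row-zDeg ρ-inj lab t₁∈ t₂∈ (κ j)) ⟩
    zDeg (t₁ *T t₂) (ρ F.zero) (κ j)          ≡⟨ sameZ (ρ F.zero) (κ j) ⟩
    zDeg (t₁′ *T t₂′) (ρ F.zero) (κ j)        ≡⟨ first-row-zDeg ρ-inj lab t₁′∈ t₂′∈ (κ j) ⟩
    zUnit (ρ F.zero) (κ j′) (ρ F.zero) (κ j)  ≡⟨ zUnit-≢ᶜ (ρ F.zero) (ρ F.zero) (j≢j′ ∘ κ-inj) ⟩
    0                                         ∎) λ ()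
  ... | yes refl =
    cong₂ (λ a b → sign j ℤ.* (a ℤ.* b))
          (trans (proj₁ (lab F.zero j t₁∈)) (sym (proj₁ (lab F.zero j t₁′∈))))
          (det-coefficient-determined m (λ e → FP.suc-injective (ρ-inj e))
                                        (λ e → FP.punchIn-injective j _ _ (κ-inj e))
                                        (minor-labelled j lab) t₂∈ t₂′∈ sameZ₂)
    where
    sameZ₂ : SameZ t₂ t₂′
    sameZ₂ r c = ℕP.+-cancelˡ-≡ (zDeg t₁ r c) _ _ (begin
      zDeg t₁ r c + zDeg t₂ r c     ≡⟨ sym (zDeg-*T t₁ t₂ r c) ⟩
      zDeg (t₁ *T t₂) r c           ≡⟨ sameZ r c ⟩
      zDeg (t₁′ *T t₂′) r c         ≡⟨ zDeg-*T t₁′ t₂′ r c ⟩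
      zDeg t₁′ r c + zDeg t₂′ r c   ≡⟨ cong (_+ zDeg t₂′ r c)
                                           (trans (proj₂ (lab F.zero j t₁′∈) r c) (sym (proj₂ (lab F.zero j t₁∈) r c))) ⟩
      zDeg t₁ r c + zDeg t₂′ r c    ∎)

  det-coeff≢0 : ∀ m {A : PolyMatrix m} {ρ κ} → Injective _≡_ _≡_ ρ → Injective _≡_ _≡_ κ →
                IsZLabelled ρ κ A → ∀ {t} → t ∈ₗ det m A → coeff (det m A) (proj₂ t) ≢ 0ℤ
  det-coeff≢0 m ρ-inj κ-inj lab t∈ =
    coeff-uniform-≢0 (det m _) (Unit⇒≢0 (det-coefficient-unit m lab t∈)) t∈
      (λ b∈ → det-coefficient-determined m ρ-inj κ-inj lab b∈ t∈ (λ _ _ → refl))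

  det-monomial⇔covering : ∀ m {A : PolyMatrix m} {ρ κ} → Injective _≡_ _≡_ ρ → Injective _≡_ _≡_ κ →
    IsZLabelled ρ κ A →
    (∃ λ mo → coeff (det m A) mo ≢ 0ℤ × AllXDivide mo) ⇔ Σ (Transversal A) Covering
  det-monomial⇔covering m {A} ρ-inj κ-inj lab = mk⇔ monomial⇒covering covering⇒monomial
    where
    monomial⇒covering : (∃ λ mo → coeff (det m A) mo ≢ 0ℤ × AllXDivide mo) → Σ (Transversal A) Covering
    monomial⇒covering (mo , c≢0 , divisible)
      with _ , t∈ ← coeff≢0⇒∈ (det m A) mo c≢0
      with T , covers ← det-term⇒transversal m A t∈
      = T , λ u → covers (divisible u)

    covering⇒monomial : Σ (Transversal A) Covering → ∃ λ mo → coeff (det m A) mo ≢ 0ℤ × AllXDivide mo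
    covering⇒monomial (T , covering)
      with t , t∈ , covered ← transversal⇒det-term m A T
      = proj₂ t , det-coeff≢0 m ρ-inj κ-inj lab t∈ ,
        λ u → let i , d = covering u in covered i d

∈-allSubsets : ∀ {k} (S : Subset k) → S ∈ₗ allSubsets k
∈-allSubsets {zero}  []ᵥ          = here refl
∈-allSubsets {suc k} (false ∷ᵥ S) = ∈-++⁺ˡ (∈-map⁺ (false ∷ᵥ_) (∈-allSubsets S))
∈-allSubsets {suc k} (true  ∷ᵥ S) =
  ∈-++⁺ʳ (map (false ∷ᵥ_) (allSubsets k)) (∈-map⁺ (true ∷ᵥ_) (∈-allSubsets S))

module _ {m} {P : Fin m → Set} (P? : ∀ x → Dec (P x)) where

  ∈-tabulate-does⁺ : ∀ {x} → P x → x ∈ tabulate (does ∘ P?)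
  ∈-tabulate-does⁺ {x} px =
    VP.lookup⇒[]= x _ (trans (VP.lookup∘tabulate (does ∘ P?) x) (dec-true (P? x) px))

  ∈-tabulate-does⁻ : ∀ {x} → x ∈ tabulate (does ∘ P?) → P x
  ∈-tabulate-does⁻ {x} x∈ with P? x | trans (sym (VP.lookup∘tabulate (does ∘ P?) x)) (VP.[]=⇒lookup x∈)
  ... | yes px | _ = px
  ... | no _   | ()

module CDMatrix {n k : ℕ} (G : Graph n) (ι : Fin k → Fin n) (ℓ : ℕ) (le : n ≤ ℓ + k) where
  open Construction G ι
  open Construction.Matrix G ι ℓ le
  open Terms {k} {N}
  open Determinant {k} {N}

  InM? : ∀ v → Dec (InM v)
  InM? v = any? (λ i → ι i F.≟ v)

  inImg? : ∀ S w → Dec (∃ λ u → u ∈ S × ι u ≡ w)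
  inImg? S w = any? λ i → (i SP.∈? S) ×-dec (ι i F.≟ w)

  ∈-img⁺ : ∀ {S u} → u ∈ S → ι u ∈ img S
  ∈-img⁺ {S} {u} u∈S = ∈-tabulate-does⁺ (inImg? S) (u , u∈S , refl)

  ∈-img⁻ : ∀ {S w} → w ∈ img S → ∃ λ u → u ∈ S × ι u ≡ w
  ∈-img⁻ {S} = ∈-tabulate-does⁻ (inImg? S)

  xTerm : Subset k → Term
  xTerm S = (1ℤ , mono (V.map (λ b → if b then 1 else 0) S) (replicate N (replicate N 0)))

  zTerm : Fin N → Fin N → Term
  zTerm r c = (1ℤ , mono (replicate k 0) (tabulate λ r′ → tabulate λ c′ → zUnit r c r′ c′))

  XDivides-xTerm⁻ : ∀ {u S} → XDivides u (xTerm S) → u ∈ S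
  XDivides-xTerm⁻ {u} {S} d rewrite VP.lookup-map u (λ b → if b then 1 else 0) S with lookup S u in e
  ... | true = VP.lookup⇒[]= u S e

  XDivides-xTerm⁺ : ∀ {u S} → u ∈ S → XDivides u (xTerm S)
  XDivides-xTerm⁺ {u} {S} u∈S rewrite VP.lookup-map u (λ b → if b then 1 else 0) S | VP.[]=⇒lookup u∈S = s≤s z≤n

  zDeg-xTerm : ∀ S r c → zDeg (xTerm S) r c ≡ 0
  zDeg-xTerm S = zDeg-oneT

  zDeg-zTerm : ∀ r c r′ c′ → zDeg (zTerm r c) r′ c′ ≡ zUnit r c r′ c′
  zDeg-zTerm r c r′ c′ rewrite VP.lookup∘tabulate (λ r′ → tabulate λ c′ → zUnit r c r′ c′) r′ =
    VP.lookup∘tabulate (zUnit r c r′) c′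

  XDivides-zTerm-*T⁻ : ∀ {u r c} t → XDivides u (zTerm r c *T t) → XDivides u t
  XDivides-zTerm-*T⁻ {r = r} {c} t d =
    [ (λ d₁ → contradiction d₁ (¬XDivides-x-free (zTerm r c) refl)) , id ] (XDivides-*T⁻ (zTerm r c) t d)

  ∈-famPoly⁻ : ∀ {P : Subset k → Set} (P? : ∀ S → Dec (P S)) {t} → t ∈ₗ famPoly {N = N} P? →
               ∃ λ S → P S × t ≡ xTerm S
  ∈-famPoly⁻ P? t∈
    with S , S∈ , here refl ← find (∈-concatMap⁻ xProd {xs = filter P? (allSubsets k)} t∈)
    = S , proj₂ (∈-filter⁻ P? {xs = allSubsets k} S∈) , refl

  ∈-famPoly⁺ : ∀ {P : Subset k → Set} (P? : ∀ S → Dec (P S)) {S} → P S → xTerm S ∈ₗ famPoly {N = N} P?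
  ∈-famPoly⁺ {P} P? {S} p =
    ∈-concatMap⁺ xProd (lose {P = λ S′ → xTerm S ∈ₗ xProd S′} (∈-filter⁺ P? (∈-allSubsets S) p) (here refl))

  InFamM⇒InFamQ : ∀ {v S} → InFamM v S → InFamQ v S
  InFamM⇒InFamQ {v} {S} (independent , v∈ , u , dominates) =
    (λ a b a∈ b∈ → independent a b (⊆img a∈) (⊆img b∈)) , u , (λ w w∈ → dominates w (⊆img w∈))
    where
    ⊆img : ∀ {w} → w ∈ img S ∪ ⁅ v ⁆ → w ∈ img S
    ⊆img {w} w∈ with SP.x∈p∪q⁻ (img S) ⁅ v ⁆ w∈
    ... | inj₁ w∈S = w∈S
    ... | inj₂ w∈v rewrite SP.x∈⁅y⁆⇒x≡y v w∈v = v∈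

  ∈-PVC⁻ : ∀ {v t} → t ∈ₗ PVC {N = N} v → ∃ λ S → InFamQ v S × t ≡ xTerm S
  ∈-PVC⁻ {v} t∈ with any? (λ i → ι i F.≟ v)
  ... | yes _ with S , p , e ← ∈-famPoly⁻ (inFamM? v) t∈ = S , InFamM⇒InFamQ p , e
  ... | no _  = ∈-famPoly⁻ (inFamQ? v) t∈

  ∈-PVC⁺ : ∀ {v S} → (InM v → InFamM v S) → InFamQ v S → xTerm S ∈ₗ PVC {N = N} v
  ∈-PVC⁺ {v} inFamM inFamQ with any? (λ i → ι i F.≟ v)
  ... | yes v∈M = ∈-famPoly⁺ (inFamM? v) (inFamM v∈M)
  ... | no _    = ∈-famPoly⁺ (inFamQ? v) inFamQ

  rows≡ : n + (N ∸ n) ≡ N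
  rows≡ = ℕP.m+[n∸m]≡n le

  rowIndex : Fin n ⊎ Fin (N ∸ n) → Fin N
  rowIndex x = F.cast rows≡ (F.join n (N ∸ n) x)

  rowOf-rowIndex : ∀ x → rowOf (rowIndex x) ≡ x
  rowOf-rowIndex x = begin
    F.splitAt n (F.cast (sym rows≡) (F.cast rows≡ (F.join n (N ∸ n) x)))
      ≡⟨ cong (F.splitAt n) (FP.cast-involutive (sym rows≡) rows≡ (F.join n (N ∸ n) x)) ⟩
    F.splitAt n (F.join n (N ∸ n) x)
      ≡⟨ FP.splitAt-join n (N ∸ n) x ⟩
    x ∎

  rowIndex-rowOf : ∀ r → rowIndex (rowOf r) ≡ r
  rowIndex-rowOf r = begin
    F.cast rows≡ (F.join n (N ∸ n) (F.splitAt n (F.cast (sym rows≡) r)))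
      ≡⟨ cong (F.cast rows≡) (FP.join-splitAt n (N ∸ n) (F.cast (sym rows≡) r)) ⟩
    F.cast rows≡ (F.cast (sym rows≡) r)
      ≡⟨ FP.cast-involutive rows≡ (sym rows≡) r ⟩
    r ∎

  rowOf-injective : Injective _≡_ _≡_ rowOf
  rowOf-injective {r} {r′} e = trans (sym (rowIndex-rowOf r)) (trans (cong rowIndex e) (rowIndex-rowOf r′))

  colOf-injective : Injective _≡_ _≡_ colOf
  colOf-injective {c} {c′} e =
    trans (sym (FP.join-splitAt ℓ k c)) (trans (cong (F.join ℓ k) e) (FP.join-splitAt ℓ k c′))

  ∈-A⁻ : ∀ {r c t} → t ∈ₗ A r c → ∃ λ t₂ → t₂ ∈ₗ entryP (rowOf r) (colOf c) × t ≡ zTerm r c *T t₂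
  ∈-A⁻ {r} {c} t∈
    with _ , t₂ , here refl , t₂∈ , refl ← ∈-*P⁻ (zVar r c) (entryP (rowOf r) (colOf c)) t∈
    = t₂ , t₂∈ , refl

  ∈-A⁺ : ∀ {r c t₂} → t₂ ∈ₗ entryP (rowOf r) (colOf c) → zTerm r c *T t₂ ∈ₗ A r c
  ∈-A⁺ {r} {c} = ∈-*P⁺ {p = zVar r c} {q = entryP (rowOf r) (colOf c)} (here refl)

  entryP-z-free : ∀ x y {t} → t ∈ₗ entryP x y → proj₁ t ≡ 1ℤ × (∀ r c → zDeg t r c ≡ 0)
  entryP-z-free (inj₂ _) _        (here refl) = refl , zDeg-oneT
  entryP-z-free (inj₁ v) (inj₂ i) t∈ with ι i F.≟ v | t∈
  ... | yes _ | here refl = refl , zDeg-oneT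
  entryP-z-free (inj₁ v) (inj₁ _) t∈ with S , _ , refl ← ∈-PVC⁻ t∈ = refl , zDeg-xTerm S

  A-labelled : IsZLabelled id id A
  A-labelled r c t∈
    with t₂ , t₂∈ , refl ← ∈-A⁻ t∈
    with coeff≡1 , z-free ← entryP-z-free (rowOf r) (colOf c) t₂∈
    = cong (1ℤ ℤ.*_) coeff≡1 , λ r′ c′ → begin
      zDeg (zTerm r c *T t₂) r′ c′          ≡⟨ zDeg-*T (zTerm r c) t₂ r′ c′ ⟩
      zDeg (zTerm r c) r′ c′ + zDeg t₂ r′ c′ ≡⟨ cong₂ _+_ (zDeg-zTerm r c r′ c′) (z-free r′ c′) ⟩
      zUnit r c r′ c′ + 0                   ≡⟨ ℕP.+-identityʳ _ ⟩
      zUnit r c r′ c′                       ∎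

  record ColourEntry (x : Fin n ⊎ Fin (N ∸ n)) (y : Fin ℓ ⊎ Fin k) (t : Term) : Set where
    field
      vertex    : Fin n
      colour    : Fin ℓ
      support   : Subset k
      row≡      : x ≡ inj₁ vertex
      column≡   : y ≡ inj₁ colour
      inFam     : InFamQ vertex support
      divides⇒∈ : ∀ {u} → XDivides u t → u ∈ support

  EntryInfo : Fin n ⊎ Fin (N ∸ n) → Fin ℓ ⊎ Fin k → Term → Set
  EntryInfo x y t = ((∀ {u} → ¬ XDivides u t) × (∀ {w} → x ≡ inj₁ w → InM w)) ⊎ ColourEntry x y t

  EntryInfo-fewerDivisors : ∀ {x y t t′} → (∀ {u} → XDivides u t′ → XDivides u t) →
                            EntryInfo x y t → EntryInfo x y t′
  EntryInfo-fewerDivisors t′⇒t (inj₁ (no-x , outsideQ)) = inj₁ (no-x ∘ t′⇒t , outsideQ)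
  EntryInfo-fewerDivisors t′⇒t (inj₂ e) =
    inj₂ record { ColourEntry e ; divides⇒∈ = divides⇒∈ ∘ t′⇒t }
    where open ColourEntry e

  entryP-info : ∀ x y {t} → t ∈ₗ entryP x y → EntryInfo x y t
  entryP-info (inj₂ _) _        (here refl) = inj₁ (¬XDivides-x-free oneT refl , λ ())
  entryP-info (inj₁ v) (inj₂ i) t∈ with ι i F.≟ v | t∈
  ... | yes ιi≡v | here refl = inj₁ (¬XDivides-x-free oneT refl , λ { refl → i , ιi≡v })
  entryP-info (inj₁ v) (inj₁ j) t∈ with S , inFam , refl ← ∈-PVC⁻ t∈ = inj₂ record
    { vertex = v ; colour = j ; support = S ; row≡ = refl ; column≡ = refl
    ; inFam = inFam ; divides⇒∈ = XDivides-xTerm⁻ }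

  A-info : ∀ r c {t} → t ∈ₗ A r c → EntryInfo (rowOf r) (colOf c) t
  A-info r c t∈ with t₂ , t₂∈ , refl ← ∈-A⁻ t∈ =
    EntryInfo-fewerDivisors (XDivides-zTerm-*T⁻ {r = r} {c} t₂) (entryP-info (rowOf r) (colOf c) t₂∈)

  block : ∀ {x y t} → EntryInfo x y t → Subset n
  block (inj₁ _) = ∅
  block (inj₂ e) = img (ColourEntry.support e) ∪ ⁅ ColourEntry.vertex e ⁆

  block-independent : ∀ {x y t} (info : EntryInfo x y t) → Independent G (block info)
  block-independent (inj₁ _) _ _ u∈ = contradiction u∈ SP.∉⊥
  block-independent (inj₂ e) = proj₁ (ColourEntry.inFam e)

  block-dominated : ∀ {x y t} (info : EntryInfo x y t) {v} → v ∈ block info → Dominated G (block info)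
  block-dominated (inj₁ _) v∈ = contradiction v∈ SP.∉⊥
  block-dominated (inj₂ e) _  = proj₂ (ColourEntry.inFam e)

  module ColouringFromCovering (T : Transversal A) (covering : Covering T) where
    open Transversal T

    rowInfo : ∀ r → EntryInfo (rowOf r) (colOf (σ r)) (term r)
    rowInfo r = A-info r (σ r) (term∈ r)

    Placement : Fin n → Set
    Placement v = ∃₂ λ r j → colOf (σ r) ≡ inj₁ j × v ∈ block (rowInfo r)

    placed-by-divisor : ∀ r {u} → XDivides u (term r) →
                        ∃ λ j → colOf (σ r) ≡ inj₁ j × ι u ∈ block (rowInfo r)
    placed-by-divisor r d with rowInfo r
    ... | inj₁ (no-x , _) = contradiction d no-x
    ... | inj₂ e = colour , column≡ , SP.p⊆p∪q ⁅ vertex ⁆ (∈-img⁺ (divides⇒∈ d))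
      where open ColourEntry e

    placed-by-own-row : ∀ {v} → ¬ InM v → ∃ λ j → colOf (σ (rowIndex (inj₁ v))) ≡ inj₁ j ×
                                                     v ∈ block (rowInfo (rowIndex (inj₁ v)))
    placed-by-own-row {v} v∉M with rowInfo (rowIndex (inj₁ v))
    ... | inj₁ (_ , outsideQ) = contradiction (outsideQ (rowOf-rowIndex (inj₁ v))) v∉M
    ... | inj₂ e with refl ← trans (sym (rowOf-rowIndex (inj₁ v))) (ColourEntry.row≡ e) =
      colour , column≡ , SP.q⊆p∪q (img support) ⁅ vertex ⁆ (SP.x∈⁅x⁆ vertex)
      where open ColourEntry e

    placement : ∀ v → Placement v
    placement v with InM? v
    ... | yes (u , refl) = let r , d = covering u in r , placed-by-divisor r d
    ... | no v∉M         = rowIndex (inj₁ v) , placed-by-own-row v∉M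

    colouring : Fin n → Fin ℓ
    colouring v = proj₁ (proj₂ (placement v))

    same-colour⇒same-block : ∀ {v w} → colouring v ≡ colouring w →
                             w ∈ block (rowInfo (proj₁ (placement v)))
    same-colour⇒same-block {v} {w} e
      with r , j , col-r , _ ← placement v | r′ , j′ , col-r′ , w∈ ← placement w
      with refl ← σ-injective (colOf-injective (trans col-r (trans (cong inj₁ e) (sym col-r′))))
      = w∈

    colouring-isCD : IsCDColoring G colouring
    colouring-isCD =
      (λ u v u~v e → block-independent (rowInfo (proj₁ (placement u))) u v
                       (proj₂ (proj₂ (proj₂ (placement u)))) (same-colour⇒same-block e) u~v) ,
      (λ v → let w , dominates = block-dominated (rowInfo (proj₁ (placement v)))
                                                 (proj₂ (proj₂ (proj₂ (placement v))))
             in w , λ x e → dominates x (same-colour⇒same-block (sym e)))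

  module CoveringFromColouring
    (clique : ∀ v w → ¬ InM v → ¬ InM w → v ≢ w → Adj G v w)
    (col : Fin n → Fin ℓ) (isCD : IsCDColoring G col) where

    proper : ∀ u v → Adj G u v → col u ≢ col v
    proper = proj₁ isCD

    colourClass : Fin n → Subset k
    colourClass v = tabulate (λ i → does (col (ι i) F.≟ col v))

    ∈-colourClass⁺ : ∀ {v i} → col (ι i) ≡ col v → i ∈ colourClass v
    ∈-colourClass⁺ {v} = ∈-tabulate-does⁺ (λ i → col (ι i) F.≟ col v)

    ∈-block⇒same-colour : ∀ {v w} → w ∈ img (colourClass v) ∪ ⁅ v ⁆ → col w ≡ col v
    ∈-block⇒same-colour {v} {w} w∈ with SP.x∈p∪q⁻ (img (colourClass v)) ⁅ v ⁆ w∈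
    ... | inj₂ w∈v rewrite SP.x∈⁅y⁆⇒x≡y v w∈v = refl
    ... | inj₁ w∈img with i , i∈ , refl ← ∈-img⁻ w∈img =
      ∈-tabulate-does⁻ (λ i → col (ι i) F.≟ col v) i∈

    colourClass-inFamQ : ∀ v → InFamQ v (colourClass v)
    colourClass-inFamQ v =
      (λ a b a∈ b∈ a~b → proper a b a~b (trans (∈-block⇒same-colour a∈) (sym (∈-block⇒same-colour b∈)))) ,
      (let u , dominates = proj₂ isCD v in u , λ w w∈ → dominates w (∈-block⇒same-colour w∈))

    colourClass-inFamM : ∀ v → InM v → InFamM v (colourClass v)
    colourClass-inFamM v (i , refl) =
      (λ a b a∈ b∈ → independent a b (SP.p⊆p∪q ⁅ v ⁆ a∈) (SP.p⊆p∪q ⁅ v ⁆ b∈)) ,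
      ∈-img⁺ (∈-colourClass⁺ refl) ,
      (u , λ w w∈ → dominates w (SP.p⊆p∪q ⁅ v ⁆ w∈))
      where
      independent = proj₁ (colourClass-inFamQ v)
      u = proj₁ (proj₂ (colourClass-inFamQ v))
      dominates = proj₂ (proj₂ (colourClass-inFamQ v))

    HasQ : Fin ℓ → Set
    HasQ j = ∃ λ w → col w ≡ j × ¬ InM w

    hasQ? : ∀ j → Dec (HasQ j)
    hasQ? j = any? (λ w → (col w F.≟ j) ×-dec ¬? (InM? w))

    representative : Fin ℓ → Maybe (Fin n)
    representative j = Maybe.map proj₁ (dec⇒maybe (any? (λ w → col w F.≟ j)))

    representative-colour : ∀ {j w} → representative j ≡ just w → col w ≡ j
    representative-colour {j} e with any? (λ w → col w F.≟ j)
    representative-colour refl | yes (_ , col≡j) = col≡j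

    representative-exists : ∀ v → ∃ λ w → representative (col v) ≡ just w
    representative-exists v with any? (λ w → col w F.≟ col v)
    ... | yes (w , _) = w , refl
    ... | no none     = contradiction (v , refl) none

    Leader : Fin n → Set
    Leader v = ¬ InM v ⊎ (¬ HasQ (col v) × representative (col v) ≡ just v)

    leader? : ∀ v → Dec (Leader v)
    leader? v = ¬? (InM? v) ⊎-dec (¬? (hasQ? (col v)) ×-dec MaybeP.≡-dec F._≟_ (representative (col v)) (just v))

    leader-unique : ∀ {v w} → Leader v → Leader w → col v ≡ col w → v ≡ w
    leader-unique {v} {w} (inj₁ v∉M) (inj₁ w∉M) e with v F.≟ w
    ... | yes v≡w = v≡w
    ... | no  v≢w = contradiction e (proper v w (clique v w v∉M w∉M v≢w))
    leader-unique {v} (inj₁ v∉M) (inj₂ (noQ , _)) e = contradiction (v , e , v∉M) noQ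
    leader-unique {w = w} (inj₂ (noQ , _)) (inj₁ w∉M) e = contradiction (w , sym e , w∉M) noQ
    leader-unique (inj₂ (_ , rep-v)) (inj₂ (_ , rep-w)) e =
      MaybeP.just-injective (trans (sym rep-v) (trans (cong representative e) rep-w))

    leader-of-colour : ∀ v → ∃ λ w → Leader w × col w ≡ col v
    leader-of-colour v with hasQ? (col v)
    ... | yes (q , col-q , q∉M) = q , inj₁ q∉M , col-q
    ... | no noQ with w , rep-w ← representative-exists v
      with col-w ← representative-colour rep-w
      = w , inj₂ (subst (¬_ ∘ HasQ) (sym col-w) noQ ,
                  subst (λ j → representative j ≡ just w) (sym col-w) rep-w) ,
        col-w

    non-leader∈M : ∀ {v} → ¬ Leader v → InM v
    non-leader∈M {v} ¬leader with InM? v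
    ... | yes v∈M = v∈M
    ... | no  v∉M = contradiction (inj₁ v∉M) ¬leader

    column : ∀ v → Dec (Leader v) → Fin N
    column v (yes _)      = col v ↑ˡ k
    column v (no ¬leader) = ℓ ↑ʳ proj₁ (non-leader∈M ¬leader)

    vertexColumn : Fin n → Fin N
    vertexColumn v = column v (leader? v)

    column-injective : ∀ {v w} (dv : Dec (Leader v)) (dw : Dec (Leader w)) → column v dv ≡ column w dw → v ≡ w
    column-injective (yes lv) (yes lw) e = leader-unique lv lw (FP.↑ˡ-injective k _ _ e)
    column-injective (no ¬lv) (no ¬lw) e
      with i , refl ← non-leader∈M ¬lv | i′ , refl ← non-leader∈M ¬lw
      = cong ι (FP.↑ʳ-injective ℓ i i′ e)
    column-injective {v} (yes _) (no ¬lw) e = contradiction e (↑ˡ≢↑ʳ (col v) _)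
    column-injective {w = w} (no ¬lv) (yes _) e = contradiction (sym e) (↑ˡ≢↑ʳ (col w) _)

    vertexColumn-injective : Injective _≡_ _≡_ vertexColumn
    vertexColumn-injective = column-injective (leader? _) (leader? _)

    vertexTerm : ∀ v → Dec (Leader v) → Term
    vertexTerm v (yes _) = xTerm (colourClass v)
    vertexTerm v (no _)  = oneT

    vertexTerm∈ : ∀ v (dv : Dec (Leader v)) → vertexTerm v dv ∈ₗ entryP (inj₁ v) (colOf (column v dv))
    vertexTerm∈ v (yes _) rewrite FP.splitAt-↑ˡ ℓ (col v) k =
      ∈-PVC⁺ (colourClass-inFamM v) (colourClass-inFamQ v)
    vertexTerm∈ v (no ¬leader) with i , refl ← non-leader∈M ¬leader
      rewrite FP.splitAt-↑ʳ ℓ k i | dec-true (ι i F.≟ ι i) refl = here refl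

    artificialColumns : ∃ λ (g : Fin (N ∸ n) → Fin N) →
                          Injective _≡_ _≡_ g × (∀ v a → vertexColumn v ≢ g a)
    artificialColumns = complementInjection (N ∸ n) rows≡ vertexColumn vertexColumn-injective

    rowColumn : Fin n ⊎ Fin (N ∸ n) → Fin N
    rowColumn = [ vertexColumn , proj₁ artificialColumns ]′

    rowTerm : Fin n ⊎ Fin (N ∸ n) → Term
    rowTerm (inj₁ v) = vertexTerm v (leader? v)
    rowTerm (inj₂ _) = oneT

    rowTerm∈ : ∀ x → rowTerm x ∈ₗ entryP x (colOf (rowColumn x))
    rowTerm∈ (inj₁ v) = vertexTerm∈ v (leader? v)
    rowTerm∈ (inj₂ _) = here refl

    transversal : Transversal A
    transversal = record
      { σ = rowColumn ∘ rowOf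
      ; σ-injective = rowOf-injective ∘
          [,]-injective vertexColumn-injective (proj₁ (proj₂ artificialColumns)) (proj₂ (proj₂ artificialColumns))
      ; term = λ r → zTerm r (rowColumn (rowOf r)) *T rowTerm (rowOf r)
      ; term∈ = λ r → ∈-A⁺ (rowTerm∈ (rowOf r))
      }

    leader-divisible : ∀ {w u} → Leader w → col (ι u) ≡ col w → XDivides u (vertexTerm w (leader? w))
    leader-divisible {w} leader col≡ with leader? w
    ... | yes _       = XDivides-xTerm⁺ (∈-colourClass⁺ col≡)
    ... | no ¬leader  = contradiction leader ¬leader

    covering : Covering transversal
    covering u with w , leader , col≡ ← leader-of-colour (ι u) =
      rowIndex (inj₁ w) ,
      subst (λ x → XDivides u (zTerm (rowIndex (inj₁ w)) (rowColumn x) *T rowTerm x))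
            (sym (rowOf-rowIndex (inj₁ w)))
            (XDivides-*Tʳ (zTerm (rowIndex (inj₁ w)) (vertexColumn w)) (vertexTerm w (leader? w))
                          (leader-divisible leader (sym col≡)))

  cdColouring⇔covering : (∀ v w → ¬ InM v → ¬ InM w → v ≢ w → Adj G v w) →
                         HasCDColoring G ℓ ⇔ Σ (Transversal A) Covering
  cdColouring⇔covering clique = mk⇔
    (λ (col , isCD) → let open CoveringFromColouring clique col isCD in transversal , covering)
    (λ (T , covering) → let open ColouringFromCovering T covering in colouring , colouring-isCD)

theorem7 : (n ℓ k : ℕ) (G : Graph n) (ι : Fin k → Fin n) →
    Injective _≡_ _≡_ ι →
    1 ≤ ℓ →
    (∀ v w → ¬ Construction.InM G ι v → ¬ Construction.InM G ι w → v ≢ w → Adj G v w) →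
    (le : n ≤ ℓ + k) →
    HasCDColoring G ℓ ⇔
      ∃ (λ m → (coeff (Construction.Matrix.detA G ι ℓ le) m ≢ 0ℤ) × AllXDivide m)
theorem7 n ℓ k G ι _ _ clique le =
  ⇔-trans (cdColouring⇔covering clique)
          (⇔-sym (det-monomial⇔covering (ℓ + k) id id A-labelled))
  where
  open CDMatrix G ι ℓ le
  open Determinant {k} {ℓ + k}
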